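{- (i) For every Steiner triple system $Y$, the Steiner triple system $2Y+1$ is $PG(2,2)$-pointed with respect to the point $*$. (ii) Every Steiner triple system $Y_1$ is a subsystem of a Steiner triple system that is $PG(3,2)$-2-pointed (with respect to some pair of points) and has $4|Y_1|+3 \equiv 7 \pmod 8$ points.
   Context: A Steiner triple system (STS) is a finite set of points with 3-element subsets (triples) such that any two distinct points lie in exactly one triple; $|Y|$ denotes the number of points of $Y$. A subsystem is a subset of points closed under taking the third point of the triple through any two of its points. The subsystem generated by a set of points is the smallest subsystem containing it. A $PG(k,2)$ subsystem is a subsystem isomorphic to the STS of points and lines of the projective space $PG(k,2)$. Given an STS $Y$, the STS $2Y+1$ has point set $Y \cup Y_1 \cup \{*\}$, where $y \mapsto y_1$ is a bijection $Y \to Y_1$ onto a disjoint copy and $*$ is a new point, and its triples are: the triples $\{a,b,c\}$ of $Y$; $\{*, a, a_1\}$ for $a \in Y$; and $\{a_1, b_1, c\}$, $\{a_1,b,c_1\}$, $\{a,b_1,c_1\}$ for each triple $\{a,b,c\}$ of $Y$. An STS is $PG(2,2)$-pointed with respect to a point $p$ if any two triples containing $p$ generate a $PG(2,2)$ subsystem. An STS with more than seven points is $PG(3,2)$-2-pointed with respect to two points if any four points including these two generate a $PG(k,2)$ subsystem for $k=2$ or $3$. -}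

module Defs where

open import Data.Nat using (ℕ; suc)
open import Data.Fin using (Fin)
open import Data.Bool using (Bool; true; false; _∨_; _xor_; T)
open import Data.Vec using (Vec; foldr′; zipWith)
open import Data.Unit using (⊤; tt)
open import Data.Sum using (_⊎_; inj₁; inj₂)
open import Data.Product using (Σ; ∃; _×_; proj₁)
open import Relation.Binary.PropositionalEquality using (_≡_; _≢_)
open import Function.Bundles using (_⇔_)
open import Function.Definitions using (Injective)

-- A ternary relation on a point set: Tr x y z means {x,y,z} is a triple.
Rel3 : Set → Set₁
Rel3 P = P → P → P → Set

record IsSTS {P : Set} (Tr : Rel3 P) : Set where
  field
    sym₁₂  : ∀ {x y z} → Tr x y z → Tr y x z
    sym₂₃  : ∀ {x y z} → Tr x y z → Tr x z y
    distinct : ∀ {x y z} → Tr x y z → x ≢ y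
    exists : ∀ {x y} → x ≢ y → ∃ λ z → Tr x y z
    unique : ∀ {x y z w} → Tr x y z → Tr x y w → z ≡ w

record STS (n : ℕ) : Set₁ where
  field
    Tr    : Rel3 (Fin n)
    isSTS : IsSTS Tr
open STS public

IsSubsystem : {P : Set} → Rel3 P → (P → Set) → Set
IsSubsystem Tr S = ∀ x y z → S x → S y → Tr x y z → S z

data Gen {P : Set} (Tr : Rel3 P) (X : P → Set) : P → Set where
  base : ∀ {x} → X x → Gen Tr X x
  step : ∀ {x y z} → Gen Tr X x → Gen Tr X y → Tr x y z → Gen Tr X z

-- PG(k,2): points are nonzero vectors of F₂^(k+1); lines {a,b,a+b}.
nonzero : ∀ {n} → Vec Bool n → Bool
nonzero = foldr′ _∨_ false

PGPt : ℕ → Set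
PGPt k = Σ (Vec Bool (suc k)) (λ v → T (nonzero v))

PGTr : (k : ℕ) → Rel3 (PGPt k)
PGTr k a b c = (proj₁ a ≢ proj₁ b) × (proj₁ c ≡ zipWith _xor_ (proj₁ a) (proj₁ b))

IsPG : {P : Set} → ℕ → Rel3 P → (P → Set) → Set
IsPG {P} k Tr S =
  Σ (PGPt k → P) λ f →
    Injective _≡_ _≡_ f
    × (∀ x → S x ⇔ (∃ λ v → f v ≡ x))
    × (∀ a b c → PGTr k a b c ⇔ Tr (f a) (f b) (f c))

PG22Pointed : {P : Set} → Rel3 P → P → Set
PG22Pointed Tr p =
  ∀ a b c d → Tr p a b → Tr p c d → c ≢ a → c ≢ b →
  IsPG 2 Tr (Gen Tr (λ x → x ≡ p ⊎ x ≡ a ⊎ x ≡ b ⊎ x ≡ c ⊎ x ≡ d))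

PG32TwoPointed : {P : Set} → Rel3 P → P → P → Set
PG32TwoPointed Tr p q =
  p ≢ q ×
  (∀ x y → x ≢ p → x ≢ q → y ≢ p → y ≢ q → x ≢ y →
    IsPG 2 Tr (Gen Tr (λ w → w ≡ p ⊎ w ≡ q ⊎ w ≡ x ⊎ w ≡ y))
    ⊎ IsPG 3 Tr (Gen Tr (λ w → w ≡ p ⊎ w ≡ q ⊎ w ≡ x ⊎ w ≡ y)))

-- The construction 2Y+1.  Points: inj₁ tt = *, inj₂ (inj₁ a) = a,
-- inj₂ (inj₂ a) = a₁.
DPt : ℕ → Set
DPt n = ⊤ ⊎ (Fin n ⊎ Fin n)

star : ∀ {n} → DPt n
star = inj₁ tt

old new : ∀ {n} → Fin n → DPt n
old a = inj₂ (inj₁ a)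
new a = inj₂ (inj₂ a)

data DBase {n : ℕ} (Y : STS n) : Rel3 (DPt n) where
  tY   : ∀ {a b c} → Tr Y a b c → DBase Y (old a) (old b) (old c)
  tS   : ∀ a → DBase Y star (old a) (new a)
  t110 : ∀ {a b c} → Tr Y a b c → DBase Y (new a) (new b) (old c)
  t101 : ∀ {a b c} → Tr Y a b c → DBase Y (new a) (old b) (new c)
  t011 : ∀ {a b c} → Tr Y a b c → DBase Y (old a) (new b) (new c)

Sym3 : {P : Set} → Rel3 P → Rel3 P
Sym3 R x y z = R x y z ⊎ R x z y ⊎ R y x z ⊎ R y z x ⊎ R z x y ⊎ R z y x

Double : ∀ {n} → STS n → Rel3 (DPt n)
Double Y = Sym3 (DBase Y)

SubsystemOf : ∀ {n m} → STS n → STS m → Set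
SubsystemOf {n} {m} Y Z =
  Σ (Fin n → Fin m) λ f →
    Injective _≡_ _≡_ f
    × IsSubsystem (Tr Z) (λ x → ∃ λ a → f a ≡ x)
    × (∀ a b c → Tr Y a b c ⇔ Tr Z (f a) (f b) (f c))

module Submission where

-- A map
-- of PG(k,2) into an STS sending lines to triples is automatically injective with a
-- subsystem as image, so a set X inside the image generates a copy of PG(k,2) as soon
-- as its preimages span F₂^(k+1); spanning of small explicit lists is decided by
-- evaluation.  Doubling turns such an embedding into Y into one of PG(k+1,2) into
-- 2Y+1: (b, v) goes to the copy in Y or Y₁ (by b) of the image of v, and (1, 0) to *.
-- (i) The triples {*, u, u₁}, {*, v, v₁} span the doubling of the line through u, v.
-- (ii) In Z = 2(2Y+1)+1 take p = *, q = old copy of *; any further x, y lie, with p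
-- and q, spanningly in the twice doubled image of a point (PG(2,2)) or of a line
-- (PG(3,2)) of Y.  |Y| is odd since x ↦ third(p₀, x) is an involution fixing only p₀.

open import Defs
open import Data.Nat using (ℕ; zero; suc; _+_; _*_; _≤_; _%_)
open import Data.Nat.Properties using (+-0-commutativeMonoid)
open import Data.Nat.DivMod using ([m+kn]%n≡m%n)
open import Data.Nat.Tactic.RingSolver using (solve-∀)
open import Data.Bool using (Bool; true; false; not; _xor_; T)
open import Data.Bool.Properties using (T-irrelevant; T-∨; xor-same; xor-identityʳ; xor-comm)
import Data.Bool.Properties as Bool
open import Data.Vec using (Vec; []; _∷_; zipWith; replicate; _∷ʳ_)
open import Data.Vec.Properties using (≡-dec; ∷-injective)
open import Data.List using (List; []; _∷_; _++_; map)
open import Data.List.Membership.Propositional using (_∈_)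
open import Data.List.Membership.Propositional.Properties
  using (∈-map⁺; ∈-map⁻; ∈-++⁺ˡ; ∈-++⁺ʳ; ∈-++⁻)
open import Data.List.Relation.Unary.All as All using (All; all?; []; _∷_)
open import Data.List.Relation.Unary.All.Properties using (map⁺)
open import Data.List.Relation.Unary.Any using (here; any?)
open import Data.Fin using (Fin; _≟_; zero; suc)
open import Data.Fin.Properties using (_<?_; <-cmp; <-asym; <-irrefl; +↔⊎; 1↔⊤)
open import Data.Fin.Permutation using (permutation)
open import Algebra.Properties.CommutativeMonoid.Sum +-0-commutativeMonoid
  using (sum; sum-cong-≗; ∑-distrib-+; sum-permute)
open import Data.Unit using (⊤; tt)
import Data.Unit.Properties as Unit
open import Data.Empty using (⊥-elim)
open import Data.Sum using (_⊎_; inj₁; inj₂; [_,_]′; map₂)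
import Data.Sum as Sum
import Data.Sum.Properties as Sum
open import Data.Sum.Function.Propositional using (_⊎-⇔_; _⊎-↔_)
open import Data.Product using (Σ; ∃; _×_; _,_; proj₁; proj₂)
open import Function using (_∘_)
open import Function.Bundles using (_⇔_; mk⇔; Equivalence; _↔_; Inverse)
open import Function.Definitions using (Injective)
open import Function.Properties.Equivalence using () renaming (trans to ⇔-trans)
open import Function.Properties.Inverse using (↔-refl; ↔-trans)
open import Relation.Binary.PropositionalEquality
open import Relation.Binary.Definitions using (DecidableEquality; tri<; tri≈; tri>)
open import Relation.Nullary using (¬_; Dec; yes; no)
open import Relation.Nullary.Decidable using (map′; from-yes)
open import Relation.Unary using (Decidable)

infixl 6 _+ᵥ_

_+ᵥ_ : ∀ {k} → Vec Bool k → Vec Bool k → Vec Bool k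
_+ᵥ_ = zipWith _xor_

0ᵥ : ∀ {k} → Vec Bool k
0ᵥ = replicate _ false

+ᵥ-identityˡ : ∀ {k} (v : Vec Bool k) → 0ᵥ +ᵥ v ≡ v
+ᵥ-identityˡ []      = refl
+ᵥ-identityˡ (x ∷ v) = cong (x ∷_) (+ᵥ-identityˡ v)

+ᵥ-identityʳ : ∀ {k} (v : Vec Bool k) → v +ᵥ 0ᵥ ≡ v
+ᵥ-identityʳ []      = refl
+ᵥ-identityʳ (x ∷ v) = cong₂ _∷_ (xor-identityʳ x) (+ᵥ-identityʳ v)

+ᵥ-self : ∀ {k} (v : Vec Bool k) → v +ᵥ v ≡ 0ᵥ
+ᵥ-self []      = refl
+ᵥ-self (x ∷ v) = cong₂ _∷_ (xor-same x) (+ᵥ-self v)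

+ᵥ-cancel : ∀ {k} (u v : Vec Bool k) → u +ᵥ v ≡ 0ᵥ → u ≡ v
+ᵥ-cancel []      []      _ = refl
+ᵥ-cancel (x ∷ u) (y ∷ v) e = cong₂ _∷_ (xor-cancel x y (proj₁ (∷-injective e)))
                                        (+ᵥ-cancel u v (proj₂ (∷-injective e)))
  where
  xor-cancel : ∀ x y → x xor y ≡ false → x ≡ y
  xor-cancel true  true  _  = refl
  xor-cancel false false _  = refl
  xor-cancel true  false ()
  xor-cancel false true  ()

nonzero-0ᵥ : ∀ {k} → ¬ T (nonzero (0ᵥ {k}))
nonzero-0ᵥ {suc k} nz = nonzero-0ᵥ {k} nz

zero-or-nonzero : ∀ {k} (v : Vec Bool k) → v ≡ 0ᵥ ⊎ T (nonzero v)
zero-or-nonzero []          = inj₁ refl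
zero-or-nonzero (true ∷ v)  = inj₂ tt
zero-or-nonzero (false ∷ v) = Sum.map (cong (false ∷_)) (λ nz → nz) (zero-or-nonzero v)

+ᵥ-nonzero : ∀ {k} {u v : Vec Bool k} → u ≢ v → T (nonzero (u +ᵥ v))
+ᵥ-nonzero {u = u} {v} u≢v with zero-or-nonzero (u +ᵥ v)
... | inj₁ u+v≡0 = ⊥-elim (u≢v (+ᵥ-cancel u v u+v≡0))
... | inj₂ nz    = nz

-- A point of PG(k,2) is determined by its vector (the nonzero proof is irrelevant).
PGPt-≡ : ∀ {k} {a b : PGPt k} → proj₁ a ≡ proj₁ b → a ≡ b
PGPt-≡ {a = v , p} {.v , q} refl = cong (v ,_) (T-irrelevant p q)

line-third : ∀ {k} (a b : PGPt k) → proj₁ a ≢ proj₁ b → PGPt k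
line-third a b a≢b = proj₁ a +ᵥ proj₁ b , +ᵥ-nonzero a≢b

allVectors : ∀ k → List (Vec Bool k)
allVectors zero    = [] ∷ []
allVectors (suc k) = map (true ∷_) (allVectors k) ++ map (false ∷_) (allVectors k)

∈-allVectors : ∀ {k} (v : Vec Bool k) → v ∈ allVectors k
∈-allVectors []                  = here refl
∈-allVectors (true ∷ v)          = ∈-++⁺ˡ (∈-map⁺ (true ∷_) (∈-allVectors v))
∈-allVectors {suc k} (false ∷ v) =
  ∈-++⁺ʳ (map (true ∷_) (allVectors k)) (∈-map⁺ (false ∷_) (∈-allVectors v))

∀-vectors? : ∀ {k} {Q : Vec Bool k → Set} → Decidable Q → Dec (∀ v → Q v)
∀-vectors? {k} Q? = map′ (λ qs v → All.lookup qs (∈-allVectors v))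
                          (λ q → All.tabulate (λ {v} _ → q v))
                          (all? Q? (allVectors k))

span : ∀ {k} → List (Vec Bool k) → List (Vec Bool k)
span []      = 0ᵥ ∷ []
span (v ∷ L) = span L ++ map (v +ᵥ_) (span L)

Spans : ∀ {k} → List (Vec Bool k) → Set
Spans L = ∀ v → v ∈ span L

spans? : ∀ {k} (L : List (Vec Bool k)) → Dec (Spans L)
spans? L = ∀-vectors? (λ v → any? (≡-dec Bool._≟_ v) (span L))

span-closed : ∀ {k} (S : Vec Bool k → Set) → S 0ᵥ → (∀ u v → S u → S v → S (u +ᵥ v)) →
              ∀ {L} → All S L → ∀ {v} → v ∈ span L → S v
span-closed S s0 s+ []       (here refl) = s0
span-closed S s0 s+ {u ∷ L} (su ∷ sL) v∈ with ∈-++⁻ (span L) v∈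
... | inj₁ v∈L = span-closed S s0 s+ sL v∈L
... | inj₂ v∈u+L with ∈-map⁻ (u +ᵥ_) v∈u+L
...   | w , w∈L , refl = s+ u w su (span-closed S s0 s+ sL w∈L)

Gen-least : ∀ {P : Set} {R : Rel3 P} {X S : P → Set} → IsSubsystem R S →
            (∀ x → X x → S x) → ∀ {x} → Gen R X x → S x
Gen-least closed X⊆S (base x∈X)   = X⊆S _ x∈X
Gen-least closed X⊆S (step g h r) = closed _ _ _ (Gen-least closed X⊆S g) (Gen-least closed X⊆S h) r

record Emb {P : Set} (R : Rel3 P) (k : ℕ) : Set where
  field
    pt    : PGPt k → P
    lines : ∀ a b c → PGTr k a b c → R (pt a) (pt b) (pt c)

Image : ∀ {P : Set} {R : Rel3 P} {k} → Emb R k → P → Set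
Image E x = ∃ λ v → Emb.pt E v ≡ x

Rel3-resp : ∀ {P : Set} (R : Rel3 P) {x y z x′ y′ z′} →
            x ≡ x′ → y ≡ y′ → z ≡ z′ → R x′ y′ z′ → R x y z
Rel3-resp R refl refl refl r = r

emb-from-pairs : ∀ {P : Set} {R : Rel3 P} {k} (pt : PGPt k → P) →
                 (∀ a b (a≢b : proj₁ a ≢ proj₁ b) → R (pt a) (pt b) (pt (line-third a b a≢b))) → Emb R k
emb-from-pairs {R = R} pt on-lines = record
  { pt    = pt
  ; lines = λ { a b c (a≢b , c≡a+b) → Rel3-resp R refl refl (cong pt (PGPt-≡ c≡a+b)) (on-lines a b a≢b) }
  }

emb-map : ∀ {P : Set} {R R′ : Rel3 P} {k} → (∀ {x y z} → R x y z → R′ x y z) → Emb R k → Emb R′ k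
emb-map h E = record { pt = Emb.pt E ; lines = λ a b c l → h (Emb.lines E a b c l) }

module EmbeddingProperties {P : Set} {R : Rel3 P} (sts : IsSTS R) {k : ℕ} (E : Emb R k) where
  open IsSTS sts
  open Emb E

  distinct-points : ∀ {a b z} → R (pt a) (pt b) z → proj₁ a ≢ proj₁ b
  distinct-points r a≡b = distinct r (cong pt (PGPt-≡ a≡b))

  third-point : ∀ {a b z} (r : R (pt a) (pt b) z) → pt (line-third a b (distinct-points r)) ≡ z
  third-point {a} {b} r = unique (lines a b (line-third a b a≢b) (a≢b , refl)) r
    where
    a≢b : proj₁ a ≢ proj₁ b
    a≢b = distinct-points r

  -- Distinct points span a line, whose image is a triple of distinct points.
  injective : ∀ {a b} → pt a ≡ pt b → a ≡ b
  injective {a} {b} pa≡pb with ≡-dec Bool._≟_ (proj₁ a) (proj₁ b)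
  ... | yes a≡b = PGPt-≡ a≡b
  ... | no  a≢b = ⊥-elim (distinct (subst (λ x → R (pt a) x (pt (line-third a b a≢b))) (sym pa≡pb)
                                          (lines a b (line-third a b a≢b) (a≢b , refl))) refl)

  reflects : ∀ a b c → R (pt a) (pt b) (pt c) → PGTr k a b c
  reflects a b c r = distinct-points r , sym (cong proj₁ (injective (third-point r)))

  image-closed : IsSubsystem R (Image E)
  image-closed _ _ _ (a , refl) (b , refl) r = line-third a b (distinct-points r) , third-point r

  module _ (X : P → Set) where

    -- The vectors whose point (if any) lies in the subsystem generated by X.
    InGen : Vec Bool (suc k) → Set
    InGen w = (nz : T (nonzero w)) → Gen R X (pt (w , nz))

    InGen-+ : ∀ u w → InGen u → InGen w → InGen (u +ᵥ w)
    InGen-+ u w gu gw nz with zero-or-nonzero u | zero-or-nonzero w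
    ... | inj₁ refl | _         = subst InGen (sym (+ᵥ-identityˡ w)) gw nz
    ... | inj₂ _    | inj₁ refl = subst InGen (sym (+ᵥ-identityʳ u)) gu nz
    ... | inj₂ nu   | inj₂ nw   with ≡-dec Bool._≟_ u w
    ...   | yes refl = ⊥-elim (nonzero-0ᵥ {suc k} (subst (T ∘ nonzero) (+ᵥ-self u) nz))
    ...   | no  u≢w  = subst (Gen R X) (cong pt (PGPt-≡ refl))
                         (step (gu nu) (gw nw) (lines (u , nu) (w , nw) (line-third (u , nu) (w , nw) u≢w)
                                                       (u≢w , refl)))

    isPG-of-spanning : (∀ x → X x → Image E x) → (L : List (PGPt k)) →
                       All (λ v → X (pt v)) L → Spans (map proj₁ L) → IsPG k R (Gen R X)
    isPG-of-spanning X⊆E L XL spans =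
      pt , injective , (λ x → mk⇔ (Gen-least image-closed X⊆E) λ { (v , refl) → in-gen v }) ,
      λ a b c → mk⇔ (lines a b c) (reflects a b c)
      where
      in-gen : ∀ v → Gen R X (pt v)
      in-gen (w , nz) = span-closed InGen (λ nz → ⊥-elim (nonzero-0ᵥ {suc k} nz)) InGen-+
                          (map⁺ (All.map (λ x∈X nz → base (subst X (cong pt (PGPt-≡ refl)) x∈X)) XL))
                          (spans w) nz

rotate : ∀ {P : Set} {R : Rel3 P} → IsSTS R → ∀ {x y z} → R x y z → R y z x
rotate sts r = IsSTS.sym₂₃ sts (IsSTS.sym₁₂ sts r)

isSTS-map : ∀ {P : Set} {R R′ : Rel3 P} → (∀ {x y z} → R x y z → R′ x y z) →
            (∀ {x y z} → R′ x y z → R x y z) → IsSTS R → IsSTS R′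
isSTS-map to from sts = record
  { sym₁₂    = λ r → to (sym₁₂ (from r))
  ; sym₂₃    = λ r → to (sym₂₃ (from r))
  ; distinct = λ r → distinct (from r)
  ; exists   = λ x≢y → proj₁ (exists x≢y) , to (proj₂ (exists x≢y))
  ; unique   = λ r s → unique (from r) (from s)
  }
  where open IsSTS sts

-- With decidable equality the third point of the triple through a and b is a
-- function (extended by third a a = a).
module ThirdPoint {P : Set} (_≟P_ : DecidableEquality P) {R : Rel3 P} (sts : IsSTS R) where
  open IsSTS sts

  third : P → P → P
  third a b with a ≟P b
  ... | yes _   = a
  ... | no  a≢b = proj₁ (exists a≢b)

  third-triple : ∀ {a b} → a ≢ b → R a b (third a b)
  third-triple {a} {b} a≢b with a ≟P b
  ... | yes a≡b  = ⊥-elim (a≢b a≡b)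
  ... | no  a≢b′ = proj₂ (exists a≢b′)

  third-unique : ∀ {a b c} → R a b c → c ≡ third a b
  third-unique r = unique r (third-triple (distinct r))

  third-self : ∀ a → third a a ≡ a
  third-self a with a ≟P a
  ... | yes _   = refl
  ... | no  a≢a = ⊥-elim (a≢a refl)

  third-comm : ∀ a b → third a b ≡ third b a
  third-comm a b = by-cases (a ≟P b)
    where
    by-cases : Dec (a ≡ b) → third a b ≡ third b a
    by-cases (yes refl) = refl
    by-cases (no  a≢b)  = third-unique (sym₁₂ (third-triple a≢b))

  third-involutive : ∀ a b → third a (third a b) ≡ b
  third-involutive a b = by-cases (a ≟P b)
    where
    by-cases : Dec (a ≡ b) → third a (third a b) ≡ b
    by-cases (yes refl) = trans (cong (third a) (third-self a)) (third-self a)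
    by-cases (no  a≢b)  = sym (third-unique (sym₂₃ (third-triple a≢b)))

-- The symmetric closure Sym3 of a ternary relation; the six orders are named by
-- the order in which the base relation sees x, y, z.

pattern xyz r = inj₁ r
pattern xzy r = inj₂ (inj₁ r)
pattern yxz r = inj₂ (inj₂ (inj₁ r))
pattern yzx r = inj₂ (inj₂ (inj₂ (inj₁ r)))
pattern zxy r = inj₂ (inj₂ (inj₂ (inj₂ (inj₁ r))))
pattern zyx r = inj₂ (inj₂ (inj₂ (inj₂ (inj₂ r))))

module _ {P : Set} {B : Rel3 P} where

  Sym3-sym₁₂ : ∀ {x y z} → Sym3 B x y z → Sym3 B y x z
  Sym3-sym₁₂ (xyz r) = yxz r
  Sym3-sym₁₂ (xzy r) = yzx r
  Sym3-sym₁₂ (yxz r) = xyz r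
  Sym3-sym₁₂ (yzx r) = xzy r
  Sym3-sym₁₂ (zxy r) = zyx r
  Sym3-sym₁₂ (zyx r) = zxy r

  Sym3-sym₂₃ : ∀ {x y z} → Sym3 B x y z → Sym3 B x z y
  Sym3-sym₂₃ (xyz r) = xzy r
  Sym3-sym₂₃ (xzy r) = xyz r
  Sym3-sym₂₃ (yxz r) = zxy r
  Sym3-sym₂₃ (yzx r) = zyx r
  Sym3-sym₂₃ (zxy r) = yxz r
  Sym3-sym₂₃ (zyx r) = yzx r

  Sym3-map : ∀ {B′ : Rel3 P} → (∀ {x y z} → B x y z → B′ x y z) →
             ∀ {x y z} → Sym3 B x y z → Sym3 B′ x y z
  Sym3-map h (xyz r) = xyz (h r)
  Sym3-map h (xzy r) = xzy (h r)
  Sym3-map h (yxz r) = yxz (h r)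
  Sym3-map h (yzx r) = yzx (h r)
  Sym3-map h (zxy r) = zxy (h r)
  Sym3-map h (zyx r) = zyx (h r)

  Sym3-distinct : (∀ {x y z} → B x y z → x ≢ y × x ≢ z × y ≢ z) →
                  ∀ {x y z} → Sym3 B x y z → x ≢ y
  Sym3-distinct d (xyz r) = proj₁ (d r)
  Sym3-distinct d (xzy r) = proj₁ (proj₂ (d r))
  Sym3-distinct d (yxz r) = ≢-sym (proj₁ (d r))
  Sym3-distinct d (yzx r) = ≢-sym (proj₁ (proj₂ (d r)))
  Sym3-distinct d (zxy r) = proj₂ (proj₂ (d r))
  Sym3-distinct d (zyx r) = ≢-sym (proj₂ (proj₂ (d r)))

  Sym3-third : (φ : P → P → P) → (∀ x y → φ x y ≡ φ y x) →
               (∀ {x y z} → B x y z → z ≡ φ x y × y ≡ φ x z × x ≡ φ y z) →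
               ∀ {x y z} → Sym3 B x y z → z ≡ φ x y
  Sym3-third φ comm t (xyz r) = proj₁ (t r)
  Sym3-third φ comm t (xzy r) = proj₁ (proj₂ (t r))
  Sym3-third φ comm t {x} {y} (yxz r) = trans (proj₁ (t r)) (comm y x)
  Sym3-third φ comm t {x} {y} (yzx r) = trans (proj₁ (proj₂ (t r))) (comm y x)
  Sym3-third φ comm t (zxy r) = proj₂ (proj₂ (t r))
  Sym3-third φ comm t {x} {y} (zyx r) = trans (proj₂ (proj₂ (t r))) (comm y x)

-- The doubling 2Y+1 over an arbitrary point set P: points ⋆, ι₀ a (= a) and
-- ι₁ a (= a₁), with the triples of Defs.DBase.

D : Set → Set
D P = ⊤ ⊎ (P ⊎ P)

pattern ⋆    = inj₁ tt
pattern ι₀ a = inj₂ (inj₁ a)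
pattern ι₁ a = inj₂ (inj₂ a)

data DTriple {P : Set} (R : Rel3 P) : Rel3 (D P) where
  tY   : ∀ {a b c} → R a b c → DTriple R (ι₀ a) (ι₀ b) (ι₀ c)
  tS   : ∀ a → DTriple R ⋆ (ι₀ a) (ι₁ a)
  t110 : ∀ {a b c} → R a b c → DTriple R (ι₁ a) (ι₁ b) (ι₀ c)
  t101 : ∀ {a b c} → R a b c → DTriple R (ι₁ a) (ι₀ b) (ι₁ c)
  t011 : ∀ {a b c} → R a b c → DTriple R (ι₀ a) (ι₁ b) (ι₁ c)

Dbl : {P : Set} → Rel3 P → Rel3 (D P)
Dbl R = Sym3 (DTriple R)

ι₀-injective : ∀ {P : Set} {a b : P} → _≡_ {A = D P} (ι₀ a) (ι₀ b) → a ≡ b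
ι₀-injective refl = refl

ι₁-injective : ∀ {P : Set} {a b : P} → _≡_ {A = D P} (ι₁ a) (ι₁ b) → a ≡ b
ι₁-injective refl = refl

D-≟ : ∀ {P : Set} → DecidableEquality P → DecidableEquality (D P)
D-≟ _≟P_ = Sum.≡-dec Unit._≟_ (Sum.≡-dec _≟P_ _≟P_)

-- 2Y+1 is an STS: its third-point function φ is computed from that of Y.
module Doubling {P : Set} (_≟P_ : DecidableEquality P) {R : Rel3 P} (sts : IsSTS R) where
  open IsSTS sts
  open ThirdPoint _≟P_ sts

  -- The third point of the triple through a and b₁.
  mix : P → P → D P
  mix a b with a ≟P b
  ... | yes _ = ⋆
  ... | no  _ = ι₁ (third a b)

  mix-self : ∀ a → mix a a ≡ ⋆
  mix-self a with a ≟P a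
  ... | yes _   = refl
  ... | no  a≢a = ⊥-elim (a≢a refl)

  mix-triple : ∀ {a b c} → R a b c → ι₁ c ≡ mix a b
  mix-triple {a} {b} r with a ≟P b
  ... | yes a≡b = ⊥-elim (distinct r a≡b)
  ... | no  _   = cong ι₁ (third-unique r)

  mix-comm : ∀ a b → mix a b ≡ mix b a
  mix-comm a b = by-cases (a ≟P b)
    where
    by-cases : Dec (a ≡ b) → mix a b ≡ mix b a
    by-cases (yes refl) = refl
    by-cases (no  a≢b)  = trans (sym (mix-triple (third-triple a≢b)))
                                (mix-triple (sym₁₂ (third-triple a≢b)))

  φ : D P → D P → D P
  φ ⋆      ⋆      = ⋆
  φ ⋆      (ι₀ a) = ι₁ a
  φ ⋆      (ι₁ a) = ι₀ a
  φ (ι₀ a) ⋆      = ι₁ a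
  φ (ι₁ a) ⋆      = ι₀ a
  φ (ι₀ a) (ι₀ b) = ι₀ (third a b)
  φ (ι₁ a) (ι₁ b) = ι₀ (third a b)
  φ (ι₀ a) (ι₁ b) = mix a b
  φ (ι₁ a) (ι₀ b) = mix a b

  φ-comm : ∀ x y → φ x y ≡ φ y x
  φ-comm ⋆      ⋆      = refl
  φ-comm ⋆      (ι₀ a) = refl
  φ-comm ⋆      (ι₁ a) = refl
  φ-comm (ι₀ a) ⋆      = refl
  φ-comm (ι₁ a) ⋆      = refl
  φ-comm (ι₀ a) (ι₀ b) = cong ι₀ (third-comm a b)
  φ-comm (ι₁ a) (ι₁ b) = cong ι₀ (third-comm a b)
  φ-comm (ι₀ a) (ι₁ b) = mix-comm a b
  φ-comm (ι₁ a) (ι₀ b) = mix-comm a b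

  DTriple-third : ∀ {x y z} → DTriple R x y z → z ≡ φ x y × y ≡ φ x z × x ≡ φ y z
  DTriple-third (tY r)   = cong ι₀ (third-unique r) , cong ι₀ (third-unique (sym₂₃ r))
                         , cong ι₀ (third-unique (rotate sts r))
  DTriple-third (tS a)   = refl , refl , sym (mix-self a)
  DTriple-third (t110 r) = cong ι₀ (third-unique r) , mix-triple (sym₂₃ r) , mix-triple (rotate sts r)
  DTriple-third (t101 r) = mix-triple r , cong ι₀ (third-unique (sym₂₃ r)) , mix-triple (rotate sts r)
  DTriple-third (t011 r) = mix-triple r , mix-triple (sym₂₃ r) , cong ι₀ (third-unique (rotate sts r))

  DTriple-distinct : ∀ {x y z} → DTriple R x y z → x ≢ y × x ≢ z × y ≢ z
  DTriple-distinct (tY r)   = distinct r ∘ ι₀-injective , distinct (sym₂₃ r) ∘ ι₀-injective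
                            , distinct (rotate sts r) ∘ ι₀-injective
  DTriple-distinct (tS a)   = (λ ()) , (λ ()) , (λ ())
  DTriple-distinct (t110 r) = distinct r ∘ ι₁-injective , (λ ()) , (λ ())
  DTriple-distinct (t101 r) = (λ ()) , distinct (sym₂₃ r) ∘ ι₁-injective , (λ ())
  DTriple-distinct (t011 r) = (λ ()) , (λ ()) , distinct (rotate sts r) ∘ ι₁-injective

  Dbl-third : ∀ {x y z} → Dbl R x y z → z ≡ φ x y
  Dbl-third = Sym3-third φ φ-comm DTriple-third

  Dbl-exists : ∀ {x y} → x ≢ y → Dbl R x y (φ x y)
  Dbl-exists {⋆}    {⋆}    x≢y = ⊥-elim (x≢y refl)
  Dbl-exists {⋆}    {ι₀ a} _   = xyz (tS a)
  Dbl-exists {⋆}    {ι₁ a} _   = xzy (tS a)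
  Dbl-exists {ι₀ a} {⋆}    _   = yxz (tS a)
  Dbl-exists {ι₁ a} {⋆}    _   = yzx (tS a)
  Dbl-exists {ι₀ a} {ι₀ b} x≢y = xyz (tY (third-triple (x≢y ∘ cong ι₀)))
  Dbl-exists {ι₁ a} {ι₁ b} x≢y = xyz (t110 (third-triple (x≢y ∘ cong ι₁)))
  Dbl-exists {ι₀ a} {ι₁ b} _   with a ≟P b
  ... | yes refl = zxy (tS a)
  ... | no  a≢b  = xyz (t011 (third-triple a≢b))
  Dbl-exists {ι₁ a} {ι₀ b} _   with a ≟P b
  ... | yes refl = zyx (tS a)
  ... | no  a≢b  = xyz (t101 (third-triple a≢b))

  Dbl-isSTS : IsSTS (Dbl R)
  Dbl-isSTS = record
    { sym₁₂    = Sym3-sym₁₂ {B = DTriple R}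
    ; sym₂₃    = Sym3-sym₂₃ {B = DTriple R}
    ; distinct = Sym3-distinct DTriple-distinct
    ; exists   = λ x≢y → _ , Dbl-exists x≢y
    ; unique   = λ r s → trans (Dbl-third r) (sym (Dbl-third s))
    }

copy : ∀ {P : Set} → Bool → P → D P
copy false = ι₀
copy true  = ι₁

module _ {P : Set} {R : Rel3 P} where

  star-first : ∀ b y → Dbl R ⋆ (copy b y) (copy (not b) y)
  star-first false y = xyz (tS y)
  star-first true  y = xzy (tS y)

  star-second : ∀ b y → Dbl R (copy b y) ⋆ (copy (not b) y)
  star-second false y = yxz (tS y)
  star-second true  y = yzx (tS y)

  star-third : ∀ b y → Dbl R (copy b y) (copy (not b) y) ⋆
  star-third false y = zxy (tS y)
  star-third true  y = zyx (tS y)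

  copy-triple : ∀ a b {x y z} → R x y z → Dbl R (copy a x) (copy b y) (copy (a xor b) z)
  copy-triple false false r = xyz (tY r)
  copy-triple false true  r = xyz (t011 r)
  copy-triple true  false r = xyz (t101 r)
  copy-triple true  true  r = xyz (t110 r)

module SmallEmbeddings {P : Set} {R : Rel3 P} (sts : IsSTS R) where
  open IsSTS sts

  point-emb : P → Emb R 0
  point-emb u = emb-from-pairs (λ _ → u) on-lines
    where
    on-lines : ∀ a b (a≢b : proj₁ a ≢ proj₁ b) → R u u u
    on-lines (true ∷ [] , _) (true ∷ [] , _) a≢b = ⊥-elim (a≢b refl)

  line-emb : ∀ {u v w} → R u v w → Emb R 1
  line-emb {u} {v} {w} r = emb-from-pairs pt on-lines
    where
    pt : PGPt 1 → P
    pt (false ∷ true  ∷ [] , _) = u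
    pt (true  ∷ false ∷ [] , _) = v
    pt (true  ∷ true  ∷ [] , _) = w
    on-lines : ∀ a b (a≢b : proj₁ a ≢ proj₁ b) → R (pt a) (pt b) (pt (line-third a b a≢b))
    on-lines (false ∷ true  ∷ [] , _) (true  ∷ false ∷ [] , _) _ = r
    on-lines (false ∷ true  ∷ [] , _) (true  ∷ true  ∷ [] , _) _ = sym₂₃ r
    on-lines (true  ∷ false ∷ [] , _) (false ∷ true  ∷ [] , _) _ = sym₁₂ r
    on-lines (true  ∷ false ∷ [] , _) (true  ∷ true  ∷ [] , _) _ = rotate sts r
    on-lines (true  ∷ true  ∷ [] , _) (false ∷ true  ∷ [] , _) _ = rotate sts (rotate sts r)
    on-lines (true  ∷ true  ∷ [] , _) (true  ∷ false ∷ [] , _) _ = sym₂₃ (rotate sts (rotate sts r))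
    on-lines (false ∷ true  ∷ [] , _) (false ∷ true  ∷ [] , _) a≢b = ⊥-elim (a≢b refl)
    on-lines (true  ∷ false ∷ [] , _) (true  ∷ false ∷ [] , _) a≢b = ⊥-elim (a≢b refl)
    on-lines (true  ∷ true  ∷ [] , _) (true  ∷ true  ∷ [] , _) a≢b = ⊥-elim (a≢b refl)

module DoubleEmbedding {P : Set} {R : Rel3 P} {k : ℕ} (E : Emb R k) where
  open Emb E

  lift : Bool → Vec Bool (suc k) → D P
  lift b v with zero-or-nonzero v
  ... | inj₁ _  = ⋆
  ... | inj₂ nz = copy b (pt (v , nz))

  lift-zero : ∀ b → lift b 0ᵥ ≡ ⋆
  lift-zero b with zero-or-nonzero (0ᵥ {suc k})
  ... | inj₁ _  = refl
  ... | inj₂ nz = ⊥-elim (nonzero-0ᵥ {suc k} nz)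

  lift-point : ∀ b {v} (p : PGPt k) → v ≡ proj₁ p → lift b v ≡ copy b (pt p)
  lift-point b {v} p refl with zero-or-nonzero v
  ... | inj₁ refl = ⊥-elim (nonzero-0ᵥ {suc k} (proj₂ p))
  ... | inj₂ nz   = cong (copy b ∘ pt) (PGPt-≡ refl)

  dpt : PGPt (suc k) → D P
  dpt (b ∷ v , _) = lift b v

  top-bit : ∀ b → T (nonzero (b ∷ 0ᵥ {suc k})) → b ≡ true
  top-bit true  _  = refl
  top-bit false nz = ⊥-elim (nonzero-0ᵥ {suc k} nz)

  not-of-≢ : ∀ {a b : Bool} → a ≢ b → b ≡ not a
  not-of-≢ {true}  {false} _   = refl
  not-of-≢ {false} {true}  _   = refl
  not-of-≢ {true}  {true}  a≢b = ⊥-elim (a≢b refl)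
  not-of-≢ {false} {false} a≢b = ⊥-elim (a≢b refl)

  -- Lines of PG(k+1,2): according to which tails vanish, a line through * or
  -- the doubling of a line of PG(k,2).
  on-lines : ∀ a b (a≢b : proj₁ a ≢ proj₁ b) → Dbl R (dpt a) (dpt b) (dpt (line-third a b a≢b))
  on-lines (a₀ ∷ av , pa) (b₀ ∷ bv , pb) a≢b = by-cases (zero-or-nonzero av) (zero-or-nonzero bv)
    where
    Goal : Set
    Goal = Dbl R (lift a₀ av) (lift b₀ bv) (lift (a₀ xor b₀) (av +ᵥ bv))
    by-cases : av ≡ 0ᵥ ⊎ T (nonzero av) → bv ≡ 0ᵥ ⊎ T (nonzero bv) → Goal
    by-cases (inj₁ refl) (inj₁ refl) =
      ⊥-elim (a≢b (cong (_∷ 0ᵥ) (trans (top-bit a₀ pa) (sym (top-bit b₀ pb)))))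
    by-cases (inj₁ refl) (inj₂ nb) with top-bit a₀ pa
    ... | refl = Rel3-resp (Dbl R) (lift-zero a₀) (lift-point b₀ (bv , nb) refl)
                   (lift-point (not b₀) (bv , nb) (+ᵥ-identityˡ bv)) (star-first b₀ _)
    by-cases (inj₂ na) (inj₁ refl) with top-bit b₀ pb
    ... | refl = Rel3-resp (Dbl R) (lift-point a₀ (av , na) refl) (lift-zero b₀)
                   (trans (cong₂ lift (xor-comm a₀ true) (+ᵥ-identityʳ av))
                          (lift-point (not a₀) (av , na) refl))
                   (star-second a₀ _)
    by-cases (inj₂ na) (inj₂ nb) with ≡-dec Bool._≟_ av bv
    ... | yes refl = Rel3-resp (Dbl R) (lift-point a₀ (av , na) refl)
                       (trans (cong (λ b → lift b av) b₀≡not-a₀) (lift-point (not a₀) (av , na) refl))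
                       (trans (cong (lift (a₀ xor b₀)) (+ᵥ-self av)) (lift-zero _)) (star-third a₀ _)
      where
      b₀≡not-a₀ : b₀ ≡ not a₀
      b₀≡not-a₀ = not-of-≢ (λ a₀≡b₀ → a≢b (cong (_∷ av) a₀≡b₀))
    ... | no av≢bv = Rel3-resp (Dbl R) (lift-point a₀ (av , na) refl) (lift-point b₀ (bv , nb) refl)
                       (lift-point (a₀ xor b₀) (line-third (av , na) (bv , nb) av≢bv) refl)
                       (copy-triple a₀ b₀ (lines _ _ _ (av≢bv , refl)))

  double-emb : Emb (Dbl R) (suc k)
  double-emb = emb-from-pairs dpt on-lines

  extend : Bool → PGPt k → PGPt (suc k)
  extend b (v , nz) = b ∷ v , Equivalence.from T-∨ (inj₂ nz)

  double-extend : ∀ b p → Emb.pt double-emb (extend b p) ≡ copy b (pt p)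
  double-extend b p = lift-point b p refl

through-star : ∀ {P : Set} {R : Rel3 P} {a b} → Dbl R ⋆ a b →
               ∃ λ u → ∃ λ s → a ≡ copy s u × b ≡ copy (not s) u
through-star (xyz (tS u)) = u , false , refl , refl
through-star (xzy (tS u)) = u , true  , refl , refl
through-star (yxz ())
through-star (yzx ())
through-star (zxy ())
through-star (zyx ())

copy-cases : ∀ {P : Set} s t (u : P) → copy t u ≡ copy s u ⊎ copy t u ≡ copy (not s) u
copy-cases false false u = inj₁ refl
copy-cases false true  u = inj₂ refl
copy-cases true  false u = inj₂ refl
copy-cases true  true  u = inj₁ refl

module DoubleOfSTS {n : ℕ} (Y : STS n) where

  to-Dbl : ∀ {x y z} → Double Y x y z → Dbl (Tr Y) x y z
  to-Dbl = Sym3-map {B = DBase Y} convert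
    where
    convert : ∀ {x y z} → DBase Y x y z → DTriple (Tr Y) x y z
    convert (tY r)   = tY r
    convert (tS a)   = tS a
    convert (t110 r) = t110 r
    convert (t101 r) = t101 r
    convert (t011 r) = t011 r

  from-Dbl : ∀ {x y z} → Dbl (Tr Y) x y z → Double Y x y z
  from-Dbl = Sym3-map {B = DTriple (Tr Y)} convert
    where
    convert : ∀ {x y z} → DTriple (Tr Y) x y z → DBase Y x y z
    convert (tY r)   = tY r
    convert (tS a)   = tS a
    convert (t110 r) = t110 r
    convert (t101 r) = t101 r
    convert (t011 r) = t011 r

  Double-isSTS : IsSTS (Double Y)
  Double-isSTS = isSTS-map from-Dbl to-Dbl (Doubling.Dbl-isSTS _≟_ (isSTS Y))

  open ThirdPoint _≟_ (isSTS Y) using (third-triple)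

  -- The triples {*, u, u₁} and {*, v, v₁} generate the doubling of the line
  -- through u and v; *, u and v have preimages 100, 001, 010.
  pointed : PG22Pointed (Double Y) star
  pointed a b c d r₁ r₂ c≢a c≢b with through-star (to-Dbl r₁) | through-star (to-Dbl r₂)
  ... | u , s , refl , refl | v , t , refl , refl =
    EmbeddingProperties.isPG-of-spanning Double-isSTS E X X⊆E L
      (inj₁ refl ∷ inj₂ (map₂ inj₁ (copy-cases s false u))
                 ∷ inj₂ (inj₂ (inj₂ (copy-cases t false v))) ∷ [])
      (from-yes (spans? (map proj₁ L)))
    where
    u≢v : u ≢ v
    u≢v refl = [ c≢a , c≢b ]′ (copy-cases s t u)
    line : Emb (Tr Y) 1
    line = SmallEmbeddings.line-emb (isSTS Y) (third-triple u≢v)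
    open DoubleEmbedding line using (extend; double-extend; double-emb)
    E : Emb (Double Y) 2
    E = emb-map from-Dbl double-emb
    X : DPt n → Set
    X x = x ≡ star ⊎ x ≡ copy s u ⊎ x ≡ copy (not s) u ⊎ x ≡ copy t v ⊎ x ≡ copy (not t) v
    pu pv : PGPt 1
    pu = false ∷ true ∷ [] , tt
    pv = true ∷ false ∷ [] , tt
    X⊆E : ∀ x → X x → Image E x
    X⊆E _ (inj₁ refl)                      = (true ∷ false ∷ false ∷ [] , tt) , refl
    X⊆E _ (inj₂ (inj₁ refl))               = extend s pu , double-extend s pu
    X⊆E _ (inj₂ (inj₂ (inj₁ refl)))        = extend (not s) pu , double-extend (not s) pu
    X⊆E _ (inj₂ (inj₂ (inj₂ (inj₁ refl)))) = extend t pv , double-extend t pv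
    X⊆E _ (inj₂ (inj₂ (inj₂ (inj₂ refl)))) = extend (not t) pv , double-extend (not t) pv
    L : List (PGPt 2)
    L = (true ∷ false ∷ false ∷ [] , tt) ∷ (false ∷ false ∷ true ∷ [] , tt)
      ∷ (false ∷ true ∷ false ∷ [] , tt) ∷ []

-- Parity.  For an involution σ of Fin m, m = #fixed points + 2·#{x | x < σ x},
-- since x ↦ σ x exchanges {x < σ x} and {σ x < x}.

χ : ∀ {A : Set} → Dec A → ℕ
χ (yes _) = 1
χ (no  _) = 0

χ-yes : ∀ {A : Set} (a? : Dec A) → A → χ a? ≡ 1
χ-yes (yes _) _ = refl
χ-yes (no ¬a) a = ⊥-elim (¬a a)

χ-no : ∀ {A : Set} (a? : Dec A) → ¬ A → χ a? ≡ 0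
χ-no (yes a) ¬a = ⊥-elim (¬a a)
χ-no (no _)  _  = refl

trichotomy-count : ∀ {m} (x y : Fin m) → χ (x <? y) + χ (y <? x) + χ (x ≟ y) ≡ 1
trichotomy-count x y with x <? y | y <? x | x ≟ y
... | yes _   | no _    | no _     = refl
... | no _    | yes _   | no _     = refl
... | no _    | no _    | yes _    = refl
... | yes x<y | yes y<x | _        = ⊥-elim (<-asym x<y y<x)
... | yes x<y | no _    | yes refl = ⊥-elim (<-irrefl refl x<y)
... | no _    | yes y<x | yes refl = ⊥-elim (<-irrefl refl y<x)
... | no x≮y  | no y≮x  | no x≢y   with <-cmp x y
...   | tri< x<y _ _ = ⊥-elim (x≮y x<y)
...   | tri≈ _ x≡y _ = ⊥-elim (x≢y x≡y)
...   | tri> _ _ y<x = ⊥-elim (y≮x y<x)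

sum-ones : ∀ m → sum {m} (λ _ → 1) ≡ m
sum-ones zero    = refl
sum-ones (suc m) = cong suc (sum-ones m)

sum-zeros : ∀ m → sum {m} (λ _ → 0) ≡ 0
sum-zeros zero    = refl
sum-zeros (suc m) = sum-zeros m

involution-count : ∀ {m} (σ : Fin m → Fin m) → (∀ x → σ (σ x) ≡ x) →
                   m ≡ sum (λ x → χ (x ≟ σ x)) + 2 * sum (λ x → χ (x <? σ x))
involution-count {m} σ σσ = begin
  m                                 ≡⟨ sym (sum-ones m) ⟩
  sum {m} (λ _ → 1)                 ≡⟨ sum-cong-≗ {m} (λ x → sym (trichotomy-count x (σ x))) ⟩
  sum (λ x → up x + down x + fix x) ≡⟨ ∑-distrib-+ (λ x → up x + down x) fix ⟩
  sum (λ x → up x + down x) + ∑fix  ≡⟨ cong (_+ ∑fix) (∑-distrib-+ up down) ⟩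
  ∑up + sum down + ∑fix             ≡⟨ cong (λ s → ∑up + s + ∑fix) (sym ∑up≡∑down) ⟩
  ∑up + ∑up + ∑fix                  ≡⟨ rearrange ∑up ∑fix ⟩
  ∑fix + 2 * ∑up                    ∎
  where
  open ≡-Reasoning
  up down fix : Fin m → ℕ
  up x   = χ (x <? σ x)
  down x = χ (σ x <? x)
  fix x  = χ (x ≟ σ x)
  ∑up ∑fix : ℕ
  ∑up  = sum up
  ∑fix = sum fix
  ∑up≡∑down : sum up ≡ sum down
  ∑up≡∑down = trans (sum-permute up (permutation σ σ σσ σσ))
                    (sum-cong-≗ {m} (λ x → cong (λ y → χ (σ x <? y)) (σσ x)))
  rearrange : ∀ a b → a + a + b ≡ b + 2 * a
  rearrange = solve-∀

-- An STS on n ≥ 1 points has n odd: x ↦ third 0 x fixes only 0.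
sts-odd : ∀ {n} (Y : STS n) → 1 ≤ n → ∃ λ u → n ≡ 1 + 2 * u
sts-odd {suc k} Y _ =
  moving , trans (involution-count σ (third-involutive zero)) (cong (_+ 2 * moving) fixed-once)
  where
  open IsSTS (isSTS Y)
  open ThirdPoint _≟_ (isSTS Y)
  σ : Fin (suc k) → Fin (suc k)
  σ = third zero
  moving : ℕ
  moving = sum (λ x → χ (x <? σ x))
  moved : ∀ i → suc i ≢ σ (suc i)
  moved i i≡σi = distinct (rotate (isSTS Y) (subst (Tr Y zero (suc i)) (sym i≡σi) (third-triple (λ ()))))
                          refl
  fixed-once : sum (λ x → χ (x ≟ σ x)) ≡ 1
  fixed-once = cong₂ _+_ (χ-yes (zero ≟ σ zero) (sym (third-self zero)))
                         (trans (sum-cong-≗ {k} (λ i → χ-no (suc i ≟ σ (suc i)) (moved i))) (sum-zeros k))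

order-mod-8 : ∀ u → (4 * (1 + 2 * u) + 3) % 8 ≡ 7
order-mod-8 u = trans (cong (_% 8) (expand u)) ([m+kn]%n≡m%n 7 u 8)
  where
  expand : ∀ u → 4 * (1 + 2 * u) + 3 ≡ 7 + u * 8
  expand = solve-∀

SubEmbedding : ∀ {P Q : Set} → Rel3 P → Rel3 Q → (P → Q) → Set
SubEmbedding R S f =
  Injective _≡_ _≡_ f × IsSubsystem S (λ x → ∃ λ a → f a ≡ x)
  × (∀ a b c → R a b c ⇔ S (f a) (f b) (f c))

sub-∘ : ∀ {P Q U : Set} {R : Rel3 P} {S : Rel3 Q} {T : Rel3 U} {f : P → Q} {g : Q → U} →
        SubEmbedding R S f → SubEmbedding S T g → SubEmbedding R T (g ∘ f)
sub-∘ {T = T} {f = f} {g = g} (f-inj , f-closed , f-iff) (g-inj , g-closed , g-iff) =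
  (λ e → f-inj (g-inj e)) , closed , λ a b c → ⇔-trans (f-iff a b c) (g-iff (f a) (f b) (f c))
  where
  closed : IsSubsystem T (λ x → ∃ λ a → g (f a) ≡ x)
  closed _ _ z (a , refl) (b , refl) t with g-closed _ _ z (f a , refl) (f b , refl) t
  ... | w , refl with f-closed _ _ w (a , refl) (b , refl) (Equivalence.from (g-iff (f a) (f b) w) t)
  ...   | c , refl = c , refl

ι₀-sub : ∀ {P : Set} (_≟P_ : DecidableEquality P) {R : Rel3 P} → IsSTS R → SubEmbedding R (Dbl R) ι₀
ι₀-sub _≟P_ {R} sts = ι₀-injective , (λ { _ _ _ (a , refl) (b , refl) r → _ , sym (Dbl-third r) }) ,
                      λ a b c → mk⇔ (λ r → xyz (tY r)) (reflect a b c)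
  where
  open Doubling _≟P_ sts
  open ThirdPoint _≟P_ sts using (third-triple)
  reflect : ∀ a b c → Dbl R (ι₀ a) (ι₀ b) (ι₀ c) → R a b c
  reflect a b c r = subst (R a b) (sym (ι₀-injective (Dbl-third r)))
                      (third-triple (λ a≡b → IsSTS.distinct Dbl-isSTS r (cong ι₀ a≡b)))

module Transport {B : Set} {m : ℕ} (I : Fin m ↔ B) {R : Rel3 B} (sts : IsSTS R) where
  open Inverse I using (to; from; strictlyInverseˡ; strictlyInverseʳ)

  R′ : Rel3 (Fin m)
  R′ x y z = R (to x) (to y) (to z)

  to-injective : ∀ {x y} → to x ≡ to y → x ≡ y
  to-injective {x} {y} e = trans (sym (strictlyInverseʳ x)) (trans (cong from e) (strictlyInverseʳ y))

  from-injective : ∀ {a b} → from a ≡ from b → a ≡ b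
  from-injective {a} {b} e = trans (sym (strictlyInverseˡ a)) (trans (cong to e) (strictlyInverseˡ b))

  R′-from : ∀ {a b c} → R a b c ⇔ R′ (from a) (from b) (from c)
  R′-from {a} {b} {c} =
    mk⇔ (Rel3-resp R (strictlyInverseˡ a) (strictlyInverseˡ b) (strictlyInverseˡ c))
        (Rel3-resp R (sym (strictlyInverseˡ a)) (sym (strictlyInverseˡ b)) (sym (strictlyInverseˡ c)))

  transported : STS m
  transported = record { Tr = R′ ; isSTS = isSTS′ }
    where
    open IsSTS sts
    isSTS′ : IsSTS R′
    isSTS′ = record
      { sym₁₂    = sym₁₂
      ; sym₂₃    = sym₂₃
      ; distinct = λ r x≡y → distinct r (cong to x≡y)
      ; exists   = λ x≢y → from (proj₁ (exists (x≢y ∘ to-injective)))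
                         , Rel3-resp R refl refl (strictlyInverseˡ _) (proj₂ (exists (x≢y ∘ to-injective)))
      ; unique   = λ r s → to-injective (unique r s)
      }

  from-sub : SubEmbedding R R′ from
  from-sub = from-injective , (λ { _ _ z (a , refl) (b , refl) _ → to z , strictlyInverseʳ z }) ,
             λ a b c → R′-from

  Gen-transport : ∀ {X : B → Set} {X′ : Fin m → Set} → (∀ w → X′ w ⇔ X (to w)) →
                  ∀ w → Gen R′ X′ w ⇔ Gen R X (to w)
  Gen-transport {X} {X′} X′⇔X w =
    mk⇔ forward (λ g → subst (Gen R′ X′) (strictlyInverseʳ w) (backward g))
    where
    open Equivalence using () renaming (to to ⇒; from to ⇐)
    forward : ∀ {w} → Gen R′ X′ w → Gen R X (to w)
    forward (base x)     = base (⇒ (X′⇔X _) x)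
    forward (step g h r) = step (forward g) (forward h) r
    backward : ∀ {b} → Gen R X b → Gen R′ X′ (from b)
    backward (base x)     = base (⇐ (X′⇔X _) (subst X (sym (strictlyInverseˡ _)) x))
    backward (step g h r) = step (backward g) (backward h) (⇒ R′-from r)

  IsPG-transport : ∀ {k} {X : B → Set} {X′ : Fin m → Set} → (∀ w → X′ w ⇔ X (to w)) →
                   IsPG k R (Gen R X) → IsPG k R′ (Gen R′ X′)
  IsPG-transport {X′ = X′} X′⇔X (f , f-inj , f-img , f-lines) =
    from ∘ f , (λ e → f-inj (from-injective e)) , img , λ a b c → ⇔-trans (f-lines a b c) R′-from
    where
    img : ∀ w → Gen R′ X′ w ⇔ (∃ λ v → from (f v) ≡ w)
    img w = ⇔-trans (Gen-transport X′⇔X w) (⇔-trans (f-img (to w))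
              (mk⇔ (λ { (v , fv≡) → v , trans (cong from fv≡) (strictlyInverseʳ w) })
                   (λ { (v , refl) → v , sym (strictlyInverseˡ (f v)) })))

  two-pointed-transport : ∀ {p q} → PG32TwoPointed R p q → PG32TwoPointed R′ (from p) (from q)
  two-pointed-transport {p} {q} (p≢q , pg) =
    p≢q ∘ from-injective ,
    λ x y x≢p x≢q y≢p y≢q x≢y →
      Sum.map (IsPG-transport (quad⇔ x y)) (IsPG-transport (quad⇔ x y))
        (pg (to x) (to y) (away x≢p) (away x≢q) (away y≢p) (away y≢q) (x≢y ∘ to-injective))
    where
    ≡-from : ∀ {w b} → w ≡ from b ⇔ to w ≡ b
    ≡-from {w} {b} = mk⇔ (λ { refl → strictlyInverseˡ b }) (λ { refl → sym (strictlyInverseʳ w) })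
    away : ∀ {w b} → w ≢ from b → to w ≢ b
    away w≢ e = w≢ (Equivalence.from ≡-from e)
    quad⇔ : ∀ x y w → (w ≡ from p ⊎ w ≡ from q ⊎ w ≡ x ⊎ w ≡ y)
                    ⇔ (to w ≡ p ⊎ to w ≡ q ⊎ to w ≡ to x ⊎ to w ≡ to y)
    quad⇔ x y w = ≡-from ⊎-⇔ ≡-from ⊎-⇔ ≡-to ⊎-⇔ ≡-to
      where
      ≡-to : ∀ {z} → w ≡ z ⇔ to w ≡ to z
      ≡-to = mk⇔ (cong to) to-injective

-- Part (ii) over D (D P): a point is *, q = ι₀ *, r = ι₁ * (zero tail, leading
-- coordinates 10, 01, 11) or copy c₁ (copy c₂ b) for a point b of P.

data DDView {P : Set} : D (D P) → Set where
  p-pt : DDView ⋆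
  q-pt : DDView (ι₀ ⋆)
  r-pt : DDView (ι₁ ⋆)
  over : ∀ c₁ c₂ b → DDView (copy c₁ (copy c₂ b))

dd-view : ∀ {P : Set} (x : D (D P)) → DDView x
dd-view ⋆           = p-pt
dd-view (ι₀ ⋆)      = q-pt
dd-view (ι₁ ⋆)      = r-pt
dd-view (ι₀ (ι₀ b)) = over false false b
dd-view (ι₀ (ι₁ b)) = over false true  b
dd-view (ι₁ (ι₀ b)) = over true  false b
dd-view (ι₁ (ι₁ b)) = over true  true  b

module TwiceDoubled {P : Set} (_≟P_ : DecidableEquality P) {R : Rel3 P} (sts : IsSTS R) where
  open ThirdPoint _≟P_ sts using (third-triple)

  Z : Rel3 (D (D P))
  Z = Dbl (Dbl R)

  Z-isSTS : IsSTS Z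
  Z-isSTS = Doubling.Dbl-isSTS (D-≟ _≟P_) (Doubling.Dbl-isSTS _≟P_ sts)

  Quad : D (D P) → D (D P) → D (D P) → Set
  Quad x y w = w ≡ ⋆ ⊎ w ≡ ι₀ ⋆ ⊎ w ≡ x ⊎ w ≡ y

  module Twice {j : ℕ} (g : Emb R j) where
    module G₁ = DoubleEmbedding g
    module G₂ = DoubleEmbedding G₁.double-emb

    E : Emb Z (suc (suc j))
    E = G₂.double-emb

    over-pt : ∀ c₁ c₂ v → Emb.pt E (G₂.extend c₁ (G₁.extend c₂ v)) ≡ copy c₁ (copy c₂ (Emb.pt g v))
    over-pt c₁ c₂ v = trans (G₂.double-extend c₁ (G₁.extend c₂ v))
                            (cong (copy c₁) (G₁.double-extend c₂ v))

    over-image : ∀ c₁ c₂ v → Image E (copy c₁ (copy c₂ (Emb.pt g v)))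
    over-image c₁ c₂ v = G₂.extend c₁ (G₁.extend c₂ v) , over-pt c₁ c₂ v

    over-in : ∀ {X : D (D P) → Set} c₁ c₂ v → X (copy c₁ (copy c₂ (Emb.pt g v))) →
              X (Emb.pt E (G₂.extend c₁ (G₁.extend c₂ v)))
    over-in {X} c₁ c₂ v = subst X (sym (over-pt c₁ c₂ v))

    p-image : Image E ⋆
    p-image = (true ∷ 0ᵥ , tt) , G₂.lift-zero true

    q-image : Image E (ι₀ ⋆)
    q-image = (false ∷ true ∷ 0ᵥ , tt) ,
              trans (G₂.lift-point false (true ∷ 0ᵥ , tt) refl) (cong ι₀ (G₁.lift-zero true))

    r-image : Image E (ι₁ ⋆)
    r-image = (true ∷ true ∷ 0ᵥ , tt) ,
              trans (G₂.lift-point true (true ∷ 0ᵥ , tt) refl) (cong ι₁ (G₁.lift-zero true))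

    quad-image : ∀ {x y} → Image E x → Image E y → ∀ w → Quad x y w → Image E w
    quad-image _  _  _ (inj₁ refl)               = p-image
    quad-image _  _  _ (inj₂ (inj₁ refl))        = q-image
    quad-image ix _  _ (inj₂ (inj₂ (inj₁ refl))) = ix
    quad-image _  iy _ (inj₂ (inj₂ (inj₂ refl))) = iy

  -- Around a point b of Y: *, q and any (c₁, c₂, 1) span F₂³.
  pg2-case : ∀ b c₁ c₂ {X : D (D P) → Set} → X ⋆ → X (ι₀ ⋆) → X (copy c₁ (copy c₂ b)) →
             (∀ x → X x → Image (Twice.E (SmallEmbeddings.point-emb sts b)) x) → IsPG 2 Z (Gen Z X)
  pg2-case b c₁ c₂ {X} Xp Xq Xx X⊆E =
    EmbeddingProperties.isPG-of-spanning Z-isSTS E X X⊆E L (Xp ∷ Xq ∷ over-in {X} c₁ c₂ pb Xx ∷ [])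
      (spans (c₁ ∷ c₂ ∷ []))
    where
    open Twice (SmallEmbeddings.point-emb sts b)
    pb : PGPt 0
    pb = true ∷ [] , tt
    L : List (PGPt 2)
    L = (true ∷ false ∷ false ∷ [] , tt) ∷ (false ∷ true ∷ false ∷ [] , tt)
      ∷ G₂.extend c₁ (G₁.extend c₂ pb) ∷ []
    vectors : Vec Bool 2 → List (Vec Bool 3)
    vectors c = (true ∷ false ∷ false ∷ []) ∷ (false ∷ true ∷ false ∷ []) ∷ (c ∷ʳ true) ∷ []
    spans : ∀ c → Spans (vectors c)
    spans = from-yes (∀-vectors? λ c → spans? (vectors c))

  -- Around a line {a, b, a+b} of Y: *, q, (c₁, c₂, 0, 1) and (d₁, d₂, 1, 0) span F₂⁴.
  pg3-case : ∀ {a b} (a≢b : a ≢ b) c₁ c₂ d₁ d₂ {X : D (D P) → Set} → X ⋆ → X (ι₀ ⋆) →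
             X (copy c₁ (copy c₂ a)) → X (copy d₁ (copy d₂ b)) →
             (∀ x → X x → Image (Twice.E (SmallEmbeddings.line-emb sts (third-triple a≢b))) x) →
             IsPG 3 Z (Gen Z X)
  pg3-case a≢b c₁ c₂ d₁ d₂ {X} Xp Xq Xx Xy X⊆E =
    EmbeddingProperties.isPG-of-spanning Z-isSTS E X X⊆E L
      (Xp ∷ Xq ∷ over-in {X} c₁ c₂ pa Xx ∷ over-in {X} d₁ d₂ pb Xy ∷ [])
      (spans (c₁ ∷ c₂ ∷ []) (d₁ ∷ d₂ ∷ []))
    where
    open Twice (SmallEmbeddings.line-emb sts (third-triple a≢b))
    pa pb : PGPt 1
    pa = false ∷ true ∷ [] , tt
    pb = true ∷ false ∷ [] , tt
    L : List (PGPt 3)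
    L = (true ∷ false ∷ false ∷ false ∷ [] , tt) ∷ (false ∷ true ∷ false ∷ false ∷ [] , tt)
      ∷ G₂.extend c₁ (G₁.extend c₂ pa) ∷ G₂.extend d₁ (G₁.extend d₂ pb) ∷ []
    vectors : Vec Bool 2 → Vec Bool 2 → List (Vec Bool 4)
    vectors c d = (true ∷ false ∷ false ∷ false ∷ []) ∷ (false ∷ true ∷ false ∷ false ∷ [])
                ∷ (c ∷ʳ false ∷ʳ true) ∷ (d ∷ʳ true ∷ʳ false) ∷ []
    spans : ∀ c d → Spans (vectors c d)
    spans = from-yes (∀-vectors? λ c → ∀-vectors? λ d → spans? (vectors c d))

  -- x and y over the same point of Y (or one of them r) give PG(2,2);
  -- over distinct points a, b they give PG(3,2) around the line through a and b.
  two-pointed : PG32TwoPointed Z ⋆ (ι₀ ⋆)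
  two-pointed = (λ ()) , λ x y x≢p x≢q y≢p y≢q x≢y →
    by-view x≢p x≢q y≢p y≢q x≢y (dd-view x) (dd-view y)
    where
    Claim : D (D P) → D (D P) → Set
    Claim x y = IsPG 2 Z (Gen Z (Quad x y)) ⊎ IsPG 3 Z (Gen Z (Quad x y))
    p∈ : ∀ {x y} → Quad x y ⋆
    p∈ = inj₁ refl
    q∈ : ∀ {x y} → Quad x y (ι₀ ⋆)
    q∈ = inj₂ (inj₁ refl)
    x∈ : ∀ {x y} → Quad x y x
    x∈ = inj₂ (inj₂ (inj₁ refl))
    y∈ : ∀ {x y} → Quad x y y
    y∈ = inj₂ (inj₂ (inj₂ refl))
    pb : PGPt 0
    pb = true ∷ [] , tt
    by-view : ∀ {x y} → x ≢ ⋆ → x ≢ ι₀ ⋆ → y ≢ ⋆ → y ≢ ι₀ ⋆ → x ≢ y → DDView x → DDView y → Claim x y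
    by-view x≢p _ _ _ _ p-pt _ = ⊥-elim (x≢p refl)
    by-view _ x≢q _ _ _ q-pt _ = ⊥-elim (x≢q refl)
    by-view _ _ y≢p _ _ _ p-pt = ⊥-elim (y≢p refl)
    by-view _ _ _ y≢q _ _ q-pt = ⊥-elim (y≢q refl)
    by-view _ _ _ _ x≢y r-pt r-pt = ⊥-elim (x≢y refl)
    by-view _ _ _ _ _ r-pt (over c₁ c₂ b) =
      inj₁ (pg2-case b c₁ c₂ p∈ q∈ y∈ (quad-image r-image (over-image c₁ c₂ pb)))
      where open Twice (SmallEmbeddings.point-emb sts b)
    by-view _ _ _ _ _ (over c₁ c₂ b) r-pt =
      inj₁ (pg2-case b c₁ c₂ p∈ q∈ x∈ (quad-image (over-image c₁ c₂ pb) r-image))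
      where open Twice (SmallEmbeddings.point-emb sts b)
    by-view _ _ _ _ _ (over c₁ c₂ a) (over d₁ d₂ b) with a ≟P b
    ... | yes refl =
      inj₁ (pg2-case a c₁ c₂ p∈ q∈ x∈ (quad-image (over-image c₁ c₂ pb) (over-image d₁ d₂ pb)))
      where open Twice (SmallEmbeddings.point-emb sts a)
    ... | no a≢b =
      inj₂ (pg3-case a≢b c₁ c₂ d₁ d₂ p∈ q∈ x∈ y∈
              (quad-image (over-image c₁ c₂ (false ∷ true ∷ [] , tt))
                          (over-image d₁ d₂ (true ∷ false ∷ [] , tt))))
      where open Twice (SmallEmbeddings.line-emb sts (third-triple a≢b))

Fin-double : ∀ m → Fin (suc (m + m)) ↔ D (Fin m)
Fin-double m = ↔-trans (+↔⊎ {1} {m + m}) (1↔⊤ ⊎-↔ +↔⊎)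

D-cong : ∀ {A B : Set} → A ↔ B → D A ↔ D B
D-cong i = ↔-refl ⊎-↔ (i ⊎-↔ i)

embedding-in-PG32-pointed : (n : ℕ) (Y₁ : STS n) → 1 ≤ n →
  Σ ℕ λ m → Σ (STS m) λ Z →
    m ≡ 4 * n + 3 × (4 * n + 3) % 8 ≡ 7 × SubsystemOf Y₁ Z
    × ∃ λ p → ∃ λ q → PG32TwoPointed (Tr Z) p q
embedding-in-PG32-pointed n Y n≥1 =
  m , transported , size n , mod-8 (sts-odd Y n≥1) ,
  (_ , sub-∘ (sub-∘ (ι₀-sub _≟_ (isSTS Y)) (ι₀-sub (D-≟ _≟_) Y₂-isSTS)) from-sub) ,
  _ , _ , two-pointed-transport two-pointed
  where
  m : ℕ
  m = suc (suc (n + n) + suc (n + n))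
  I : Fin m ↔ D (D (Fin n))
  I = ↔-trans (Fin-double (suc (n + n))) (D-cong (Fin-double n))
  Y₂-isSTS : IsSTS (Dbl (Tr Y))
  Y₂-isSTS = Doubling.Dbl-isSTS _≟_ (isSTS Y)
  open TwiceDoubled _≟_ (isSTS Y) using (Z-isSTS; two-pointed)
  open Transport I Z-isSTS
  size : ∀ n → suc (suc (n + n) + suc (n + n)) ≡ 4 * n + 3
  size = solve-∀
  mod-8 : (∃ λ u → n ≡ 1 + 2 * u) → (4 * n + 3) % 8 ≡ 7
  mod-8 (u , refl) = order-mod-8 u

lemma2p2 :
    ((n : ℕ) (Y : STS n) → PG22Pointed (Double Y) star)
    × ((n : ℕ) (Y₁ : STS n) → 1 ≤ n →
        Σ ℕ λ m → Σ (STS m) λ Z →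
          m ≡ 4 * n + 3 × (4 * n + 3) % 8 ≡ 7 × SubsystemOf Y₁ Z
          × ∃ λ p → ∃ λ q → PG32TwoPointed (Tr Z) p q)
lemma2p2 = (λ n Y → DoubleOfSTS.pointed Y) , embedding-in-PG32-pointed
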